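{- For every sequent $\Gamma\Rightarrow\Delta$ (with $|\Delta|\le1$) over $\mathcal{L}$: $\Gamma\Rightarrow\Delta$ is derivable in $\mathsf{S.ConstCK}$ if and only if $\iota(\Gamma\Rightarrow\Delta)$ is derivable in $\mathsf{ConstCK}$.
   Context: Language $\mathcal{L}$: formulas $\varphi ::= p \mid \bot \mid \varphi\wedge\varphi \mid \varphi\vee\varphi \mid \varphi\to\varphi \mid \varphi \mathbin{\Box\!\!\rightarrow} \varphi \mid \varphi \mathbin{\Diamond\!\!\rightarrow}\varphi$; $\wedge,\vee$ bind more strongly than $\to,\mathbin{\Box\!\!\rightarrow},\mathbin{\Diamond\!\!\rightarrow}$; $\neg\varphi:=\varphi\to\bot$, $\top:=\neg\bot$, $\varphi\leftrightarrow\psi:=(\varphi\to\psi)\wedge(\psi\to\varphi)$. $\mathsf{ConstCK}$: an axiomatisation of intuitionistic propositional logic in $\mathcal{L}$ with modus ponens, plus axioms CM$_\Box$: $(\varphi\mathbin{\Box\!\!\rightarrow}\psi\wedge\chi)\to(\varphi\mathbin{\Box\!\!\rightarrow}\psi)\wedge(\varphi\mathbin{\Box\!\!\rightarrow}\chi)$; CC$_\Box$: $(\varphi\mathbin{\Box\!\!\rightarrow}\psi)\wedge(\varphi\mathbin{\Box\!\!\rightarrow}\chi)\to(\varphi\mathbin{\Box\!\!\rightarrow}\psi\wedge\chi)$; CN$_\Box$: $\varphi\mathbin{\Box\!\!\rightarrow}\top$; CN$_\Diamond$: $\neg(\varphi\mathbin{\Diamond\!\!\rightarrow}\bot)$; CK$_\Diamond$: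 $(\varphi\mathbin{\Box\!\!\rightarrow}(\psi\to\chi))\to((\varphi\mathbin{\Diamond\!\!\rightarrow}\psi)\to(\varphi\mathbin{\Diamond\!\!\rightarrow}\chi))$; and rules RA$_\Box$: from $\varphi\leftrightarrow\rho$ infer $(\varphi\mathbin{\Box\!\!\rightarrow}\psi)\leftrightarrow(\rho\mathbin{\Box\!\!\rightarrow}\psi)$; RC$_\Box$: from $\psi\leftrightarrow\chi$ infer $(\varphi\mathbin{\Box\!\!\rightarrow}\psi)\leftrightarrow(\varphi\mathbin{\Box\!\!\rightarrow}\chi)$; RA$_\Diamond$, RC$_\Diamond$ the same with $\mathbin{\Diamond\!\!\rightarrow}$. Sequents $\Gamma\Rightarrow\Delta$: finite multisets with $|\Delta|\le1$; $\iota(\Gamma\Rightarrow\Delta)=\bigwedge\Gamma\to\bigvee\Delta$ if $\Gamma\neq\emptyset$ and $\bigvee\Delta$ if $\Gamma=\emptyset$, with $\bigvee\emptyset=\bot$. $\varphi\Leftrightarrow\rho$ abbreviates the two sequents $\varphi\Rightarrow\rho$, $\rho\Rightarrow\varphi$. Rules of $\mathsf{S.ConstCK}$ ($|\Delta|\le1$, $n\ge0$): init: $\Gamma,p\Rightarrow p$; $\bot_L$: $\Gamma,\bot\Rightarrow\Delta$; $\wedge_L$: $\Gamma,\varphi,\psi\Rightarrow\Delta$ / $\Gamma,\varphi\wedge\psi\Rightarrow\Delta$; $\wedge_R$: $\Gamma\Rightarrow\varphi$, $\Gamma\Rightarrow\psi$ / $\Gamma\Rightarrow\varphi\wedge\psi$;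 $\vee_L$: $\Gamma,\varphi\Rightarrow\Delta$, $\Gamma,\psi\Rightarrow\Delta$ / $\Gamma,\varphi\vee\psi\Rightarrow\Delta$; $\vee_R^1$: $\Gamma\Rightarrow\varphi$ / $\Gamma\Rightarrow\varphi\vee\psi$; $\vee_R^2$: $\Gamma\Rightarrow\psi$ / $\Gamma\Rightarrow\varphi\vee\psi$; $\to_R$: $\Gamma,\varphi\Rightarrow\psi$ / $\Gamma\Rightarrow\varphi\to\psi$; $\to_L$: $\Gamma,\varphi\to\psi\Rightarrow\varphi$, $\Gamma,\psi\Rightarrow\Delta$ / $\Gamma,\varphi\to\psi\Rightarrow\Delta$; $\Box$: $\{\varphi\Leftrightarrow\rho_i\}_{i\le n}$, $\sigma_1,\dots,\sigma_n\Rightarrow\psi$ / $\Gamma,\rho_1\mathbin{\Box\!\!\rightarrow}\sigma_1,\dots,\rho_n\mathbin{\Box\!\!\rightarrow}\sigma_n\Rightarrow\varphi\mathbin{\Box\!\!\rightarrow}\psi$; $\Diamond$: $\{\varphi\Leftrightarrow\rho_i\}_{i\le n}$, $\varphi\Leftrightarrow\eta$, $\sigma_1,\dots,\sigma_n,\psi\Rightarrow\vartheta$ / $\Gamma,\rho_1\mathbin{\Box\!\!\rightarrow}\sigma_1,\dots,\rho_n\mathbin{\Box\!\!\rightarrow}\sigma_n,\varphi\mathbin{\Diamond\!\!\rightarrow}\psi\Rightarrow\eta\mathbin{\Diamond\!\!\rightarrow}\vartheta$; $\Box\Diamond$: $\{\varphi\Leftrightarrow\rho_i\}_{i\le n}$,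 $\sigma_1,\dots,\sigma_n,\psi\Rightarrow$ / $\Gamma,\rho_1\mathbin{\Box\!\!\rightarrow}\sigma_1,\dots,\rho_n\mathbin{\Box\!\!\rightarrow}\sigma_n,\varphi\mathbin{\Diamond\!\!\rightarrow}\psi\Rightarrow\Delta$. -}

module Defs where

open import Data.Nat using (ℕ)
open import Data.List using (List; []; _∷_; map; _++_)
open import Data.List.Relation.Unary.All using (All)
open import Data.List.Relation.Binary.Permutation.Propositional using (_↭_)
open import Data.Maybe using (Maybe; just; nothing)
open import Data.Product using (_×_; _,_; proj₁; proj₂)

infixr 6 _∧̇_ _∨̇_
infixr 5 _⇒̇_ _□→_ _◇→_
data Fm : Set where
  var  : ℕ → Fm
  ⊥̇    : Fm
  _∧̇_  : Fm → Fm → Fm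
  _∨̇_  : Fm → Fm → Fm
  _⇒̇_  : Fm → Fm → Fm
  _□→_ : Fm → Fm → Fm
  _◇→_ : Fm → Fm → Fm

¬̇_ : Fm → Fm
¬̇ φ = φ ⇒̇ ⊥̇

⊤̇ : Fm
⊤̇ = ¬̇ ⊥̇

_⇔̇_ : Fm → Fm → Fm
φ ⇔̇ ψ = (φ ⇒̇ ψ) ∧̇ (ψ ⇒̇ φ)

data ⊢H_ : Fm → Set where
  ax-K   : ∀ φ ψ → ⊢H (φ ⇒̇ (ψ ⇒̇ φ))
  ax-S   : ∀ φ ψ χ → ⊢H ((φ ⇒̇ (ψ ⇒̇ χ)) ⇒̇ ((φ ⇒̇ ψ) ⇒̇ (φ ⇒̇ χ)))
  ax-∧E₁ : ∀ φ ψ → ⊢H (φ ∧̇ ψ ⇒̇ φ)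
  ax-∧E₂ : ∀ φ ψ → ⊢H (φ ∧̇ ψ ⇒̇ ψ)
  ax-∧I  : ∀ φ ψ → ⊢H (φ ⇒̇ (ψ ⇒̇ φ ∧̇ ψ))
  ax-∨I₁ : ∀ φ ψ → ⊢H (φ ⇒̇ φ ∨̇ ψ)
  ax-∨I₂ : ∀ φ ψ → ⊢H (ψ ⇒̇ φ ∨̇ ψ)
  ax-∨E  : ∀ φ ψ χ → ⊢H ((φ ⇒̇ χ) ⇒̇ ((ψ ⇒̇ χ) ⇒̇ (φ ∨̇ ψ ⇒̇ χ)))
  ax-⊥E  : ∀ φ → ⊢H (⊥̇ ⇒̇ φ)
  mp     : ∀ {φ ψ} → ⊢H (φ ⇒̇ ψ) → ⊢H φ → ⊢H ψ
  CM□ : ∀ φ ψ χ → ⊢H ((φ □→ ψ ∧̇ χ) ⇒̇ (φ □→ ψ) ∧̇ (φ □→ χ))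
  CC□ : ∀ φ ψ χ → ⊢H ((φ □→ ψ) ∧̇ (φ □→ χ) ⇒̇ (φ □→ ψ ∧̇ χ))
  CN□ : ∀ φ → ⊢H (φ □→ ⊤̇)
  CN◇ : ∀ φ → ⊢H (¬̇ (φ ◇→ ⊥̇))
  CK◇ : ∀ φ ψ χ → ⊢H ((φ □→ (ψ ⇒̇ χ)) ⇒̇ ((φ ◇→ ψ) ⇒̇ (φ ◇→ χ)))
  RA□ : ∀ {φ ρ} ψ → ⊢H (φ ⇔̇ ρ) → ⊢H ((φ □→ ψ) ⇔̇ (ρ □→ ψ))
  RC□ : ∀ φ {ψ χ} → ⊢H (ψ ⇔̇ χ) → ⊢H ((φ □→ ψ) ⇔̇ (φ □→ χ))
  RA◇ : ∀ {φ ρ} ψ → ⊢H (φ ⇔̇ ρ) → ⊢H ((φ ◇→ ψ) ⇔̇ (ρ ◇→ ψ))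
  RC◇ : ∀ φ {ψ χ} → ⊢H (ψ ⇔̇ χ) → ⊢H ((φ ◇→ ψ) ⇔̇ (φ ◇→ χ))

-- Sequents: antecedent a multiset (list up to permutation), succedent
-- has at most one formula (Maybe Fm).

Ctx : Set
Ctx = List Fm

Succ : Set
Succ = Maybe Fm

boxes : List (Fm × Fm) → Ctx
boxes = map (λ p → proj₁ p □→ proj₂ p)

infix 3 _⊢S_
mutual
  _⊢S⇔_ : Fm → Fm → Set
  φ ⊢S⇔ ρ = ((φ ∷ []) ⊢S just ρ) × ((ρ ∷ []) ⊢S just φ)

  data _⊢S_ : Ctx → Succ → Set where
    init : ∀ {Γ' Γ p} → Γ' ↭ (var p ∷ Γ) → Γ' ⊢S just (var p)
    ⊥L   : ∀ {Γ' Γ Δ} → Γ' ↭ (⊥̇ ∷ Γ) → Γ' ⊢S Δ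
    ∧L   : ∀ {Γ' Γ Δ φ ψ} → Γ' ↭ ((φ ∧̇ ψ) ∷ Γ) →
           (φ ∷ ψ ∷ Γ) ⊢S Δ → Γ' ⊢S Δ
    ∧R   : ∀ {Γ φ ψ} → Γ ⊢S just φ → Γ ⊢S just ψ → Γ ⊢S just (φ ∧̇ ψ)
    ∨L   : ∀ {Γ' Γ Δ φ ψ} → Γ' ↭ ((φ ∨̇ ψ) ∷ Γ) →
           (φ ∷ Γ) ⊢S Δ → (ψ ∷ Γ) ⊢S Δ → Γ' ⊢S Δ
    ∨R₁  : ∀ {Γ φ ψ} → Γ ⊢S just φ → Γ ⊢S just (φ ∨̇ ψ)
    ∨R₂  : ∀ {Γ φ ψ} → Γ ⊢S just ψ → Γ ⊢S just (φ ∨̇ ψ)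
    ⇒R   : ∀ {Γ φ ψ} → (φ ∷ Γ) ⊢S just ψ → Γ ⊢S just (φ ⇒̇ ψ)
    ⇒L   : ∀ {Γ' Γ Δ φ ψ} → Γ' ↭ ((φ ⇒̇ ψ) ∷ Γ) →
           ((φ ⇒̇ ψ) ∷ Γ) ⊢S just φ → (ψ ∷ Γ) ⊢S Δ → Γ' ⊢S Δ
    □R   : ∀ {Γ' Γ φ ψ} (ps : List (Fm × Fm)) → Γ' ↭ (boxes ps ++ Γ) →
           All (λ p → φ ⊢S⇔ proj₁ p) ps →
           map proj₂ ps ⊢S just ψ →
           Γ' ⊢S just (φ □→ ψ)
    ◇R   : ∀ {Γ' Γ φ ψ η ϑ} (ps : List (Fm × Fm)) →
           Γ' ↭ (boxes ps ++ ((φ ◇→ ψ) ∷ Γ)) →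
           All (λ p → φ ⊢S⇔ proj₁ p) ps →
           φ ⊢S⇔ η →
           (map proj₂ ps ++ ψ ∷ []) ⊢S just ϑ →
           Γ' ⊢S just (η ◇→ ϑ)
    □◇   : ∀ {Γ' Γ Δ φ ψ} (ps : List (Fm × Fm)) →
           Γ' ↭ (boxes ps ++ ((φ ◇→ ψ) ∷ Γ)) →
           All (λ p → φ ⊢S⇔ proj₁ p) ps →
           (map proj₂ ps ++ ψ ∷ []) ⊢S nothing →
           Γ' ⊢S Δ

⋁ : Succ → Fm
⋁ nothing  = ⊥̇
⋁ (just φ) = φ

⋀⁺ : Fm → Ctx → Fm
⋀⁺ φ []       = φ
⋀⁺ φ (ψ ∷ Γ)  = φ ∧̇ ⋀⁺ ψ Γ

ι : Ctx → Succ → Fm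
ι []      Δ = ⋁ Δ
ι (φ ∷ Γ) Δ = ⋀⁺ φ Γ ⇒̇ ⋁ Δ

-- Soundness: each rule of S.ConstCK is a derived rule of ConstCK with hypotheses.
-- The box rule collects its boxes with CN□ and CC□ after aligning their antecedents
-- by RA□; the diamond rules are CK◇ applied to such a box, followed by RA◇ or CN◇.
-- Completeness: the axioms and rules of ConstCK have direct sequent derivations, so it
-- remains to simulate modus ponens, i.e. to show that cut is admissible. This goes by
-- induction on the cut formula and then on the two derivations. A principal box or
-- diamond is absorbed by the modal rule below it by merging the two lists of boxes, the
-- equivalences of antecedents being composed by cuts on those smaller formulas. The
-- multiset reading of antecedents makes contraction necessary; it is admissible together
-- with weakening and the left inversions, and contracting boxed formulas uses decidable
-- equality of formulas. Finally ι(Γ ⇒ Δ) is equivalent to Γ ⇒ Δ by ∧-inversion on the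
-- left and a cut on ⊥ on the right.

module Submission where

open import Defs
open import Data.Empty using (⊥-elim)
open import Data.List using (List; []; _∷_; [_]; map; _++_)
open import Data.List.Properties using (map-++; ++-assoc; ++-identityʳ)
open import Data.List.Membership.Propositional using (_∈_)
open import Data.List.Membership.Propositional.Properties using (∈-++⁻; ∈-++⁺ˡ; ∈-++⁺ʳ; ∈-map⁻; ∈-∃++)
open import Data.List.Relation.Binary.Permutation.Propositional
open import Data.List.Relation.Binary.Permutation.Propositional.Properties
  using (All-resp-↭; ∈-resp-↭; drop-∷; shift; shifts; ++⁺ˡ; ++⁺ʳ; ++⁺; ++-comm; map⁺)
open import Data.List.Relation.Binary.Subset.Propositional using (_⊆_)
import Data.List.Relation.Binary.Subset.Propositional.Properties as ⊆
open import Data.List.Relation.Unary.All as All using (All; []; _∷_)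
import Data.List.Relation.Unary.All.Properties as All
open import Data.List.Relation.Unary.Any using (here; there)
open import Data.Maybe using (just; nothing)
import Data.Nat as ℕ
open import Data.Product using (_×_; _,_; proj₁; proj₂; ∃; uncurry)
open import Data.Sum using (_⊎_; inj₁; inj₂)
open import Data.Unit using (⊤; tt)
open import Function using (_∘_; id)
open import Relation.Binary.Definitions using (DecidableEquality)
open import Relation.Binary.PropositionalEquality as Eq using (_≡_; refl; sym; cong; cong₂; subst)
open import Relation.Nullary using (yes; no; ¬_; _×-dec_)
import Relation.Nullary.Decidable as Dec

infix 4 _≟_
_≟_ : DecidableEquality Fm
var m ≟ var n = Dec.map′ (cong var) (λ { refl → refl }) (m ℕ.≟ n)
⊥̇ ≟ ⊥̇ = yes refl
(a ∧̇ b) ≟ (c ∧̇ d) = Dec.map′ (uncurry (cong₂ _∧̇_)) (λ { refl → refl , refl }) (a ≟ c ×-dec b ≟ d)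
(a ∨̇ b) ≟ (c ∨̇ d) = Dec.map′ (uncurry (cong₂ _∨̇_)) (λ { refl → refl , refl }) (a ≟ c ×-dec b ≟ d)
(a ⇒̇ b) ≟ (c ⇒̇ d) = Dec.map′ (uncurry (cong₂ _⇒̇_)) (λ { refl → refl , refl }) (a ≟ c ×-dec b ≟ d)
(a □→ b) ≟ (c □→ d) = Dec.map′ (uncurry (cong₂ _□→_)) (λ { refl → refl , refl }) (a ≟ c ×-dec b ≟ d)
(a ◇→ b) ≟ (c ◇→ d) = Dec.map′ (uncurry (cong₂ _◇→_)) (λ { refl → refl , refl }) (a ≟ c ×-dec b ≟ d)
var _ ≟ ⊥̇ = no λ ()
var _ ≟ (_ ∧̇ _) = no λ ()
var _ ≟ (_ ∨̇ _) = no λ ()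
var _ ≟ (_ ⇒̇ _) = no λ ()
var _ ≟ (_ □→ _) = no λ ()
var _ ≟ (_ ◇→ _) = no λ ()
⊥̇ ≟ var _ = no λ ()
⊥̇ ≟ (_ ∧̇ _) = no λ ()
⊥̇ ≟ (_ ∨̇ _) = no λ ()
⊥̇ ≟ (_ ⇒̇ _) = no λ ()
⊥̇ ≟ (_ □→ _) = no λ ()
⊥̇ ≟ (_ ◇→ _) = no λ ()
(_ ∧̇ _) ≟ var _ = no λ ()
(_ ∧̇ _) ≟ ⊥̇ = no λ ()
(_ ∧̇ _) ≟ (_ ∨̇ _) = no λ ()
(_ ∧̇ _) ≟ (_ ⇒̇ _) = no λ ()
(_ ∧̇ _) ≟ (_ □→ _) = no λ ()
(_ ∧̇ _) ≟ (_ ◇→ _) = no λ ()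
(_ ∨̇ _) ≟ var _ = no λ ()
(_ ∨̇ _) ≟ ⊥̇ = no λ ()
(_ ∨̇ _) ≟ (_ ∧̇ _) = no λ ()
(_ ∨̇ _) ≟ (_ ⇒̇ _) = no λ ()
(_ ∨̇ _) ≟ (_ □→ _) = no λ ()
(_ ∨̇ _) ≟ (_ ◇→ _) = no λ ()
(_ ⇒̇ _) ≟ var _ = no λ ()
(_ ⇒̇ _) ≟ ⊥̇ = no λ ()
(_ ⇒̇ _) ≟ (_ ∧̇ _) = no λ ()
(_ ⇒̇ _) ≟ (_ ∨̇ _) = no λ ()
(_ ⇒̇ _) ≟ (_ □→ _) = no λ ()
(_ ⇒̇ _) ≟ (_ ◇→ _) = no λ ()
(_ □→ _) ≟ var _ = no λ ()
(_ □→ _) ≟ ⊥̇ = no λ ()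
(_ □→ _) ≟ (_ ∧̇ _) = no λ ()
(_ □→ _) ≟ (_ ∨̇ _) = no λ ()
(_ □→ _) ≟ (_ ⇒̇ _) = no λ ()
(_ □→ _) ≟ (_ ◇→ _) = no λ ()
(_ ◇→ _) ≟ var _ = no λ ()
(_ ◇→ _) ≟ ⊥̇ = no λ ()
(_ ◇→ _) ≟ (_ ∧̇ _) = no λ ()
(_ ◇→ _) ≟ (_ ∨̇ _) = no λ ()
(_ ◇→ _) ≟ (_ ⇒̇ _) = no λ ()
(_ ◇→ _) ≟ (_ □→ _) = no λ ()

∈⇒↭∷ : ∀ {A : Set} {x : A} {xs} → x ∈ xs → ∃ λ ys → xs ↭ x ∷ ys
∈⇒↭∷ x∈xs with ∈-∃++ x∈xs
... | ys , zs , refl = ys ++ zs , shift _ ys zs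

module _ {A B : Set} (_≟ᴮ_ : DecidableEquality B) {f : A → B}
         (f-injective : ∀ {x y} → f x ≡ f y → x ≡ y) where

  open import Data.List.Membership.DecPropositional _≟ᴮ_ using (_∈?_)

  -- xs up to repetitions, arranged so that its image under f is a sub-multiset of ys
  record Contraction (ys : List B) (xs : List A) : Set where
    constructor contraction
    field
      contracted : List A
      contracted⊆ : contracted ⊆ xs
      ⊆contracted : xs ⊆ contracted
      remainder : List B
      split : ys ↭ map f contracted ++ remainder

  contract : ∀ {ys} xs → All (λ x → f x ∈ ys) xs → Contraction ys xs
  contract {ys} [] [] = contraction [] (λ ()) (λ ()) ys ↭-refl
  contract (x ∷ xs) (fx∈ys ∷ fxs∈ys) with contract xs fxs∈ys
  ... | contraction cs cs⊆ ⊆cs rem split with f x ∈? map f cs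
  ...   | yes fx∈ with ∈-map⁻ f fx∈
  ...     | _ , x′∈cs , fx≡fx′ =
    contraction cs (⊆.⊆-trans cs⊆ (⊆.xs⊆x∷xs xs x))
                (⊆.∈-∷⁺ʳ (subst (_∈ cs) (sym (f-injective fx≡fx′)) x′∈cs) ⊆cs) rem split
  contract (x ∷ xs) (fx∈ys ∷ _) | contraction cs cs⊆ ⊆cs rem split | no fx∉
    with ∈-++⁻ (map f cs) (∈-resp-↭ split fx∈ys)
  ... | inj₁ fx∈ = ⊥-elim (fx∉ fx∈)
  ... | inj₂ fx∈rem with ∈⇒↭∷ fx∈rem
  ...   | rem′ , ρ = contraction (x ∷ cs) (⊆.∷⁺ʳ x cs⊆) (⊆.∷⁺ʳ x ⊆cs) rem′
                       (↭-trans split (↭-trans (++⁺ˡ (map f cs) ρ) (shift (f x) (map f cs) rem′)))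

↭-∷-cases : ∀ {A : Set} {a x : A} {xs ys} → a ∷ xs ↭ x ∷ ys →
            (x ≡ a × xs ↭ ys) ⊎ ∃ λ zs → xs ↭ x ∷ zs × ys ↭ a ∷ zs
↭-∷-cases {a = a} {x} {xs} {ys} π with ∈-resp-↭ π (here refl)
... | here a≡x = inj₁ (sym a≡x , drop-∷ (subst (λ z → a ∷ xs ↭ z ∷ ys) (sym a≡x) π))
... | there a∈ys with ∈⇒↭∷ a∈ys
...   | zs , ρ = inj₂ (zs , drop-∷ (↭-trans π (↭-trans (prep x ρ) (swap x a ↭-refl))) , ρ)

↭-map++-cases : ∀ {A B : Set} (f : A → B) {b : B} {ys zs} xs → b ∷ ys ↭ map f xs ++ zs →
                (∃ λ ws → zs ↭ b ∷ ws × ys ↭ map f xs ++ ws) ⊎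
                ∃ λ x → ∃ λ xs′ → b ≡ f x × xs ↭ x ∷ xs′ × ys ↭ map f xs′ ++ zs
↭-map++-cases f {b} xs π with ∈-++⁻ (map f xs) (∈-resp-↭ π (here refl))
... | inj₂ b∈zs with ∈⇒↭∷ b∈zs
...   | ws , ρ = inj₁ (ws , ρ , drop-∷ (↭-trans π (↭-trans (++⁺ˡ (map f xs) ρ) (shift b (map f xs) ws))))
↭-map++-cases f {zs = zs} xs π | inj₁ b∈fxs with ∈-map⁻ f b∈fxs
... | x , x∈xs , refl with ∈⇒↭∷ x∈xs
...   | xs′ , ρ = inj₂ (x , xs′ , refl , ρ , drop-∷ (↭-trans π (++⁺ʳ zs (map⁺ f ρ))))

++⊆ : ∀ {A : Set} {xs ys zs : List A} → xs ⊆ zs → ys ⊆ zs → xs ++ ys ⊆ zs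
++⊆ {xs = xs} xs⊆ ys⊆ x∈ with ∈-++⁻ xs x∈
... | inj₁ x∈xs = xs⊆ x∈xs
... | inj₂ x∈ys = ys⊆ x∈ys

↭-middle : ∀ {A : Set} (xs us : List A) {ys vs} → ys ↭ us ++ vs → xs ++ ys ↭ us ++ xs ++ vs
↭-middle xs us ρ = ↭-trans (++⁺ˡ xs ρ) (shifts xs us)

↭-interleave : ∀ {A : Set} {xs ys : List A} us vs ws zs →
               xs ↭ us ++ vs → ys ↭ ws ++ zs → xs ++ ys ↭ (us ++ ws) ++ vs ++ zs
↭-interleave us vs ws zs ρ σ =
  ↭-trans (++⁺ ρ σ) (↭-trans (↭-reflexive (++-assoc us vs (ws ++ zs)))
          (↭-trans (++⁺ˡ us (shifts vs ws)) (↭-reflexive (sym (++-assoc us ws (vs ++ zs))))))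

↭-⊆-++ : ∀ {A : Set} (xs : List A) {ys zs} → ys ↭ zs → zs ⊆ xs ++ ys
↭-⊆-++ xs ys↭zs = ⊆.⊆-trans (⊆.⊆-reflexive-↭ (↭-sym ys↭zs)) (⊆.xs⊆ys++xs _ xs)

box : Fm × Fm → Fm
box p = proj₁ p □→ proj₂ p

box-injective : ∀ {p q} → box p ≡ box q → p ≡ q
box-injective {_ , _} {_ , _} refl = refl

diamond∉boxes : ∀ {φ ψ} ps → ¬ (φ ◇→ ψ) ∈ boxes ps
diamond∉boxes ps ◇∈ with ∈-map⁻ box ◇∈
... | _ , _ , ()

-- Γ ⊩ φ: φ is in Γ, or is assembled from Γ as the premises of an invertible left
-- rule would assemble it.  ⊢S-mono makes weakening, contraction and inversion of
-- ∧L, ∨L and the right premise of ⇒L admissible in one induction.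
infix 4 _⊩_
_⊩_ : Ctx → Fm → Set
Γ ⊩ var n = var n ∈ Γ
Γ ⊩ ⊥̇ = ⊥̇ ∈ Γ
Γ ⊩ (φ ∧̇ ψ) = (φ ∧̇ ψ) ∈ Γ ⊎ (Γ ⊩ φ × Γ ⊩ ψ)
Γ ⊩ (φ ∨̇ ψ) = (φ ∨̇ ψ) ∈ Γ ⊎ (Γ ⊩ φ ⊎ Γ ⊩ ψ)
Γ ⊩ (φ ⇒̇ ψ) = (φ ⇒̇ ψ) ∈ Γ ⊎ Γ ⊩ ψ
Γ ⊩ (φ □→ ψ) = (φ □→ ψ) ∈ Γ
Γ ⊩ (φ ◇→ ψ) = (φ ◇→ ψ) ∈ Γ

∈⇒⊩ : ∀ {Γ} φ → φ ∈ Γ → Γ ⊩ φ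
∈⇒⊩ (var _) = id
∈⇒⊩ ⊥̇ = id
∈⇒⊩ (_ ∧̇ _) = inj₁
∈⇒⊩ (_ ∨̇ _) = inj₁
∈⇒⊩ (_ ⇒̇ _) = inj₁
∈⇒⊩ (_ □→ _) = id
∈⇒⊩ (_ ◇→ _) = id

⊆⇒⊩ : ∀ {Γ Θ} → Γ ⊆ Θ → All (Θ ⊩_) Γ
⊆⇒⊩ Γ⊆Θ = All.tabulate (∈⇒⊩ _ ∘ Γ⊆Θ)

⊩-trans : ∀ {Γ Θ} → All (Θ ⊩_) Γ → ∀ φ → Γ ⊩ φ → Θ ⊩ φ
⊩-trans Θ⊩Γ (var _) φ∈ = All.lookup Θ⊩Γ φ∈
⊩-trans Θ⊩Γ ⊥̇ φ∈ = All.lookup Θ⊩Γ φ∈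
⊩-trans Θ⊩Γ (φ ∧̇ ψ) (inj₁ φ∈) = All.lookup Θ⊩Γ φ∈
⊩-trans Θ⊩Γ (φ ∧̇ ψ) (inj₂ (⊩φ , ⊩ψ)) = inj₂ (⊩-trans Θ⊩Γ φ ⊩φ , ⊩-trans Θ⊩Γ ψ ⊩ψ)
⊩-trans Θ⊩Γ (φ ∨̇ ψ) (inj₁ φ∈) = All.lookup Θ⊩Γ φ∈
⊩-trans Θ⊩Γ (φ ∨̇ ψ) (inj₂ (inj₁ ⊩φ)) = inj₂ (inj₁ (⊩-trans Θ⊩Γ φ ⊩φ))
⊩-trans Θ⊩Γ (φ ∨̇ ψ) (inj₂ (inj₂ ⊩ψ)) = inj₂ (inj₂ (⊩-trans Θ⊩Γ ψ ⊩ψ))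
⊩-trans Θ⊩Γ (φ ⇒̇ ψ) (inj₁ φ∈) = All.lookup Θ⊩Γ φ∈
⊩-trans Θ⊩Γ (φ ⇒̇ ψ) (inj₂ ⊩ψ) = inj₂ (⊩-trans Θ⊩Γ ψ ⊩ψ)
⊩-trans Θ⊩Γ (_ □→ _) φ∈ = All.lookup Θ⊩Γ φ∈
⊩-trans Θ⊩Γ (_ ◇→ _) φ∈ = All.lookup Θ⊩Γ φ∈

⊩-trans* : ∀ {Γ Θ Ξ} → All (Θ ⊩_) Γ → All (Γ ⊩_) Ξ → All (Θ ⊩_) Ξ
⊩-trans* Θ⊩Γ = All.map (⊩-trans Θ⊩Γ _)

⊩-premise : ∀ {Γ Γ′ Ξ χ} Ψ → Γ ↭ χ ∷ Γ′ → (Ψ ++ Γ′) ⊩ χ → All (Γ ⊩_) Ξ →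
            All ((Ψ ++ Γ′) ⊩_) (Ψ ++ Ξ)
⊩-premise {Γ′ = Γ′} Ψ ρ ⊩χ Γ⊩Ξ =
  All.++⁺ (⊆⇒⊩ (⊆.xs⊆xs++ys Ψ Γ′))
          (⊩-trans* (All-resp-↭ (↭-sym ρ) (⊩χ ∷ ⊆⇒⊩ (⊆.xs⊆ys++xs Γ′ Ψ))) Γ⊩Ξ)

contract-boxes : ∀ {Γ Ξ} ps → All (Γ ⊩_) (boxes ps ++ Ξ) → Contraction _≟_ box-injective Γ ps
contract-boxes ps Γ⊩ = contract _≟_ box-injective ps (All.map⁻ (All.++⁻ˡ (boxes ps) Γ⊩))

diamond-in-remainder : ∀ {Γ Ξ φ ψ} ps → Γ ↭ boxes ps ++ Ξ → (φ ◇→ ψ) ∈ Γ →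
                       ∃ λ Ξ′ → Γ ↭ boxes ps ++ (φ ◇→ ψ) ∷ Ξ′
diamond-in-remainder ps ρ ◇∈ with ∈-++⁻ (boxes ps) (∈-resp-↭ ρ ◇∈)
... | inj₁ ◇∈boxes = ⊥-elim (diamond∉boxes ps ◇∈boxes)
... | inj₂ ◇∈Ξ with ∈⇒↭∷ ◇∈Ξ
...   | Ξ′ , σ = Ξ′ , ↭-trans ρ (++⁺ˡ (boxes ps) σ)

⊢S-mono : ∀ {Γ Γ′ Δ} → All (Γ′ ⊩_) Γ → Γ ⊢S Δ → Γ′ ⊢S Δ
⊢S-mono Γ′⊩Γ (init π) with All-resp-↭ π Γ′⊩Γ
... | p∈ ∷ _ = init (proj₂ (∈⇒↭∷ p∈))
⊢S-mono Γ′⊩Γ (⊥L π) with All-resp-↭ π Γ′⊩Γ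
... | ⊥∈ ∷ _ = ⊥L (proj₂ (∈⇒↭∷ ⊥∈))
⊢S-mono Γ′⊩Γ (∧L {φ = φ} {ψ} π d) with All-resp-↭ π Γ′⊩Γ
... | inj₂ (⊩φ , ⊩ψ) ∷ Γ′⊩Γ₀ = ⊢S-mono (⊩φ ∷ ⊩ψ ∷ Γ′⊩Γ₀) d
... | inj₁ ∧∈ ∷ Γ′⊩Γ₀ with ∈⇒↭∷ ∧∈
...   | Γ₁ , ρ = ∧L ρ (⊢S-mono (⊩-premise (φ ∷ ψ ∷ []) ρ ⊩φ∧ψ Γ′⊩Γ₀) d)
    where
      ⊩φ∧ψ : φ ∷ ψ ∷ Γ₁ ⊩ φ ∧̇ ψ
      ⊩φ∧ψ = inj₂ (∈⇒⊩ φ (here refl) , ∈⇒⊩ ψ (there (here refl)))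
⊢S-mono Γ′⊩Γ (∨L {φ = φ} {ψ} π d e) with All-resp-↭ π Γ′⊩Γ
... | inj₂ (inj₁ ⊩φ) ∷ Γ′⊩Γ₀ = ⊢S-mono (⊩φ ∷ Γ′⊩Γ₀) d
... | inj₂ (inj₂ ⊩ψ) ∷ Γ′⊩Γ₀ = ⊢S-mono (⊩ψ ∷ Γ′⊩Γ₀) e
... | inj₁ ∨∈ ∷ Γ′⊩Γ₀ with ∈⇒↭∷ ∨∈
...   | _ , ρ = ∨L ρ (⊢S-mono (⊩-premise [ φ ] ρ (inj₂ (inj₁ (∈⇒⊩ φ (here refl)))) Γ′⊩Γ₀) d)
                     (⊢S-mono (⊩-premise [ ψ ] ρ (inj₂ (inj₂ (∈⇒⊩ ψ (here refl)))) Γ′⊩Γ₀) e)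
⊢S-mono Γ′⊩Γ (⇒L {φ = φ} {ψ} π d e) with All-resp-↭ π Γ′⊩Γ
... | inj₂ ⊩ψ ∷ Γ′⊩Γ₀ = ⊢S-mono (⊩ψ ∷ Γ′⊩Γ₀) e
... | inj₁ ⇒∈ ∷ Γ′⊩Γ₀ with ∈⇒↭∷ ⇒∈
...   | _ , ρ = ⇒L ρ (⊢S-mono (⊩-premise [ φ ⇒̇ ψ ] ρ (∈⇒⊩ (φ ⇒̇ ψ) (here refl)) Γ′⊩Γ₀) d)
                     (⊢S-mono (⊩-premise [ ψ ] ρ (inj₂ (∈⇒⊩ ψ (here refl))) Γ′⊩Γ₀) e)
⊢S-mono Γ′⊩Γ (∧R d e) = ∧R (⊢S-mono Γ′⊩Γ d) (⊢S-mono Γ′⊩Γ e)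
⊢S-mono Γ′⊩Γ (∨R₁ d) = ∨R₁ (⊢S-mono Γ′⊩Γ d)
⊢S-mono Γ′⊩Γ (∨R₂ d) = ∨R₂ (⊢S-mono Γ′⊩Γ d)
⊢S-mono {Γ′ = Γ′} Γ′⊩Γ (⇒R {φ = φ} d) =
  ⇒R (⊢S-mono (∈⇒⊩ φ (here refl) ∷ ⊩-trans* (⊆⇒⊩ (⊆.xs⊆x∷xs Γ′ φ)) Γ′⊩Γ) d)
⊢S-mono Γ′⊩Γ (□R ps π eqs d) with contract-boxes ps (All-resp-↭ π Γ′⊩Γ)
... | contraction cs cs⊆ ⊆cs _ split =
  □R cs split (⊆.All-resp-⊇ cs⊆ eqs) (⊢S-mono (⊆⇒⊩ (⊆.map⁺ proj₂ ⊆cs)) d)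
⊢S-mono Γ′⊩Γ (◇R {ψ = ψ} ps π eqs eq d) with All-resp-↭ π Γ′⊩Γ
... | Γ′⊩ with contract-boxes ps Γ′⊩
...   | contraction cs cs⊆ ⊆cs _ split
        with diamond-in-remainder cs split (All.head (All.++⁻ʳ (boxes ps) Γ′⊩))
...     | _ , split◇ =
  ◇R cs split◇ (⊆.All-resp-⊇ cs⊆ eqs) eq (⊢S-mono (⊆⇒⊩ (⊆.++⁺ˡ [ ψ ] (⊆.map⁺ proj₂ ⊆cs))) d)
⊢S-mono Γ′⊩Γ (□◇ {ψ = ψ} ps π eqs d) with All-resp-↭ π Γ′⊩Γ
... | Γ′⊩ with contract-boxes ps Γ′⊩
...   | contraction cs cs⊆ ⊆cs _ split
        with diamond-in-remainder cs split (All.head (All.++⁻ʳ (boxes ps) Γ′⊩))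
...     | _ , split◇ =
  □◇ cs split◇ (⊆.All-resp-⊇ cs⊆ eqs) (⊢S-mono (⊆⇒⊩ (⊆.++⁺ˡ [ ψ ] (⊆.map⁺ proj₂ ⊆cs))) d)

⊢S-⊆ : ∀ {Γ Γ′ Δ} → Γ ⊆ Γ′ → Γ ⊢S Δ → Γ′ ⊢S Δ
⊢S-⊆ = ⊢S-mono ∘ ⊆⇒⊩

⊢S-resp-↭ : ∀ {Γ Γ′ Δ} → Γ ↭ Γ′ → Γ ⊢S Δ → Γ′ ⊢S Δ
⊢S-resp-↭ = ⊢S-⊆ ∘ ⊆.⊆-reflexive-↭

⊢S-id : ∀ φ {Γ} → φ ∷ Γ ⊢S just φ
⊢S-id (var _) = init ↭-refl
⊢S-id ⊥̇ = ⊥L ↭-refl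
⊢S-id (φ ∧̇ ψ) = ∧L ↭-refl (∧R (⊢S-id φ) (⊢S-⊆ (⊆.xs⊆x∷xs _ φ) (⊢S-id ψ)))
⊢S-id (φ ∨̇ ψ) = ∨L ↭-refl (∨R₁ (⊢S-id φ)) (∨R₂ (⊢S-id ψ))
⊢S-id (φ ⇒̇ ψ) = ⇒R (⇒L (swap _ _ ↭-refl) (⊢S-⊆ (⊆.xs⊆x∷xs _ _) (⊢S-id φ)) (⊢S-id ψ))
⊢S-id (φ □→ ψ) = □R [ (φ , ψ) ] ↭-refl ((⊢S-id φ , ⊢S-id φ) ∷ []) (⊢S-id ψ)
⊢S-id (φ ◇→ ψ) = ◇R [] ↭-refl [] (⊢S-id φ , ⊢S-id φ) (⊢S-id ψ)

⊢S-∈ : ∀ {φ Γ} → φ ∈ Γ → Γ ⊢S just φ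
⊢S-∈ {φ} φ∈ = ⊢S-⊆ (⊆.∈-∷⁺ʳ φ∈ ⊆.⊆-refl) (⊢S-id φ)

#0 : ∀ {φ Γ} → φ ∷ Γ ⊢S just φ
#0 = ⊢S-id _

#1 : ∀ {φ ψ Γ} → ψ ∷ φ ∷ Γ ⊢S just φ
#1 = ⊢S-∈ (there (here refl))

#2 : ∀ {φ ψ χ Γ} → χ ∷ ψ ∷ φ ∷ Γ ⊢S just φ
#2 = ⊢S-∈ (there (there (here refl)))

↭-boxes-++ : ∀ {Γ Θ Γ₀ Θ₀} ps qs → Γ ↭ boxes ps ++ Γ₀ → Θ ↭ boxes qs ++ Θ₀ →
             Γ ++ Θ ↭ boxes (ps ++ qs) ++ Γ₀ ++ Θ₀
↭-boxes-++ {Γ₀ = Γ₀} {Θ₀} ps qs ρ σ =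
  subst (λ bs → _ ↭ bs ++ Γ₀ ++ Θ₀) (sym (map-++ box ps qs))
        (↭-interleave (boxes ps) Γ₀ (boxes qs) Θ₀ ρ σ)

premises-++ : ∀ (ps qs : List (Fm × Fm)) Ψ →
              map proj₂ (ps ++ qs) ++ Ψ ≡ map proj₂ ps ++ map proj₂ qs ++ Ψ
premises-++ ps qs Ψ = Eq.trans (cong (_++ Ψ) (map-++ proj₂ ps qs)) (++-assoc (map proj₂ ps) (map proj₂ qs) Ψ)

↭-premises : ∀ (ps qs : List (Fm × Fm)) ψ →
             (map proj₂ ps ++ [ ψ ]) ++ map proj₂ qs ↭ map proj₂ (ps ++ qs) ++ [ ψ ]
↭-premises ps qs ψ =
  ↭-trans (↭-reflexive (++-assoc (map proj₂ ps) [ ψ ] (map proj₂ qs)))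
          (↭-trans (++⁺ˡ (map proj₂ ps) (++-comm [ ψ ] (map proj₂ qs)))
                   (↭-reflexive (sym (premises-++ ps qs [ ψ ]))))

-- Θ′ is left arbitrary up to permutation so that the induction on the right
-- derivation never has to reorder it.
Cut : Fm → Set
Cut χ = ∀ {Γ Θ Θ′ Δ} → Γ ⊢S just χ → Θ′ ⊢S Δ → Θ′ ↭ χ ∷ Θ → Γ ++ Θ ⊢S Δ

SubformulaCut : Fm → Set
SubformulaCut (φ ∧̇ ψ) = Cut φ × Cut ψ
SubformulaCut (φ ∨̇ ψ) = Cut φ × Cut ψ
SubformulaCut (φ ⇒̇ ψ) = Cut φ × Cut ψ
SubformulaCut (φ □→ ψ) = Cut φ × Cut ψ
SubformulaCut (φ ◇→ ψ) = Cut φ × Cut ψ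
SubformulaCut _ = ⊤

⇔-trans : ∀ {φ ρ ρ′} → Cut ρ → φ ⊢S⇔ ρ → ρ ⊢S⇔ ρ′ → φ ⊢S⇔ ρ′
⇔-trans cut-ρ (φ⇒ρ , ρ⇒φ) (ρ⇒ρ′ , ρ′⇒ρ) = cut-ρ φ⇒ρ ρ⇒ρ′ ↭-refl , cut-ρ ρ′⇒ρ ρ⇒φ ↭-refl

data RightRule {Γ : Ctx} : {χ : Fm} → Γ ⊢S just χ → Set where
  by-∧R  : ∀ {φ ψ} {d : Γ ⊢S just φ} {e : Γ ⊢S just ψ} → RightRule (∧R d e)
  by-∨R₁ : ∀ {φ ψ} {d : Γ ⊢S just φ} → RightRule (∨R₁ {ψ = ψ} d)
  by-∨R₂ : ∀ {φ ψ} {d : Γ ⊢S just ψ} → RightRule (∨R₂ {φ = φ} d)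
  by-⇒R  : ∀ {φ ψ} {d : φ ∷ Γ ⊢S just ψ} → RightRule (⇒R d)
  by-□R  : ∀ {Γ₀ φ ψ ps} {π : Γ ↭ boxes ps ++ Γ₀} {eqs : All (λ p → φ ⊢S⇔ proj₁ p) ps}
             {d : map proj₂ ps ⊢S just ψ} → RightRule (□R ps π eqs d)
  by-◇R  : ∀ {Γ₀ φ ψ η ϑ ps} {π : Γ ↭ boxes ps ++ (φ ◇→ ψ) ∷ Γ₀}
             {eqs : All (λ p → φ ⊢S⇔ proj₁ p) ps} {eq : φ ⊢S⇔ η}
             {d : map proj₂ ps ++ [ ψ ] ⊢S just ϑ} → RightRule (◇R ps π eqs eq d)

-- A principal r □→ s cut against one of the boxes of a modal rule is replaced by
-- the boxes of the □R that derived it.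
merge-boxes : ∀ {r s φ Ψ Δ psL ps ps′} → Cut r × Cut s →
              All (λ p → r ⊢S⇔ proj₁ p) psL → map proj₂ psL ⊢S just s →
              ps ↭ (r , s) ∷ ps′ → All (λ p → φ ⊢S⇔ proj₁ p) ps → map proj₂ ps ++ Ψ ⊢S Δ →
              All (λ p → φ ⊢S⇔ proj₁ p) (psL ++ ps′) × map proj₂ (psL ++ ps′) ++ Ψ ⊢S Δ
merge-boxes {Ψ = Ψ} {psL = psL} {ps′ = ps′} (cut-r , cut-s) eqsL dL ps↭ eqs e
  with All-resp-↭ ps↭ eqs
... | φ⇔r ∷ eqs′ =
  All.++⁺ (All.map (⇔-trans cut-r φ⇔r) eqsL) eqs′ ,
  subst (_⊢S _) (sym (premises-++ psL ps′ Ψ)) (cut-s dL e (++⁺ʳ Ψ (map⁺ proj₂ ps↭)))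

cut-□R : ∀ {χ} → SubformulaCut χ → ∀ {Γ Θ Ξ φ ψ} (d : Γ ⊢S just χ) → RightRule d →
         ∀ ps → χ ∷ Θ ↭ boxes ps ++ Ξ → All (λ p → φ ⊢S⇔ proj₁ p) ps →
         map proj₂ ps ⊢S just ψ → Γ ++ Θ ⊢S just (φ □→ ψ)
cut-□R ih {Γ} d rf ps π eqs e with ↭-map++-cases box ps π
... | inj₁ (_ , _ , Θ↭) = □R ps (↭-middle Γ (boxes ps) Θ↭) eqs e
... | inj₂ (_ , ps′ , refl , ps↭ , Θ↭) with rf
...   | by-□R {ps = psL} {π = πL} {eqs = eqsL} {d = dL}
        with merge-boxes ih eqsL dL ps↭ eqs (subst (_⊢S _) (sym (++-identityʳ _)) e)
...     | eqs″ , e″ = □R (psL ++ ps′) (↭-boxes-++ psL ps′ πL Θ↭) eqs″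
                         (subst (_⊢S _) (++-identityʳ _) e″)

-- The common part of ◇R and □◇. A cut may replace the antecedent φ of the diamond
-- by some φ′, which inherits every equivalence of φ.
record DiamondPremise (Γ : Ctx) (φ : Fm) (Δ : Succ) : Set where
  constructor diamond-premise
  field
    {φ′ ψ} : Fm
    {Ξ} : Ctx
    boxed : List (Fm × Fm)
    split : Γ ↭ boxes boxed ++ (φ′ ◇→ ψ) ∷ Ξ
    boxed⇔ : All (λ p → φ′ ⊢S⇔ proj₁ p) boxed
    φ′⇔ : ∀ {η} → φ ⊢S⇔ η → φ′ ⊢S⇔ η
    premise : map proj₂ boxed ++ [ ψ ] ⊢S Δ

cut-◇ : ∀ {χ} → SubformulaCut χ → ∀ {Γ Θ Ξ φ ψ Δ} (d : Γ ⊢S just χ) → RightRule d →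
        ∀ ps → χ ∷ Θ ↭ boxes ps ++ (φ ◇→ ψ) ∷ Ξ → All (λ p → φ ⊢S⇔ proj₁ p) ps →
        map proj₂ ps ++ [ ψ ] ⊢S Δ → DiamondPremise (Γ ++ Θ) φ Δ
cut-◇ ih d rf ps π eqs e with ↭-map++-cases box ps π
... | inj₂ (_ , ps′ , refl , ps↭ , Θ↭) with rf
...   | by-□R {Γ₀ = ΓL} {ps = psL} {π = πL} {eqs = eqsL} {d = dL}
        with merge-boxes ih eqsL dL ps↭ eqs e
...     | eqs″ , e″ = diamond-premise (psL ++ ps′)
                        (↭-trans (↭-boxes-++ psL ps′ πL Θ↭) (++⁺ˡ (boxes (psL ++ ps′)) (shift _ ΓL _)))
                        eqs″ id e″
cut-◇ ih {Γ} d rf ps π eqs e | inj₁ (_ , ◇∷Ξ↭ , Θ↭) with ↭-∷-cases ◇∷Ξ↭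
... | inj₂ (_ , _ , Ξ₀↭) =
  diamond-premise ps (↭-trans (↭-middle Γ (boxes ps) Θ↭) (++⁺ˡ (boxes ps) (↭-middle Γ [ _ ] Ξ₀↭)))
                  eqs id e
... | inj₁ (refl , _) with rf | ih
...   | by-◇R {ψ = ψL} {ps = psL} {π = πL} {eqs = eqsL} {eq = φL⇔φ} {d = dL} | cut-φ , cut-ψ =
  diamond-premise (psL ++ ps) (↭-boxes-++ psL ps πL Θ↭)
    (All.++⁺ eqsL (All.map (⇔-trans cut-φ φL⇔φ) eqs)) (⇔-trans cut-φ φL⇔φ)
    (⊢S-resp-↭ (↭-premises psL ps ψL) (cut-ψ dL e (++-comm (map proj₂ ps) [ _ ])))

mutual
  cut-right : ∀ {χ} → SubformulaCut χ → ∀ {Γ Θ Θ′ Δ} (d : Γ ⊢S just χ) → RightRule d →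
              Θ′ ⊢S Δ → Θ′ ↭ χ ∷ Θ → Γ ++ Θ ⊢S Δ
  cut-right ih d rf (init ρ) π with ↭-∷-cases (↭-trans (↭-sym π) ρ)
  ... | inj₁ (refl , _) with rf
  ...   | ()
  cut-right ih {Γ} d rf (init ρ) π | inj₂ (_ , Θ↭ , _) = init (↭-middle Γ [ _ ] Θ↭)
  cut-right ih d rf (⊥L ρ) π with ↭-∷-cases (↭-trans (↭-sym π) ρ)
  ... | inj₁ (refl , _) with rf
  ...   | ()
  cut-right ih {Γ} d rf (⊥L ρ) π | inj₂ (_ , Θ↭ , _) = ⊥L (↭-middle Γ [ ⊥̇ ] Θ↭)
  cut-right ih {Γ} {Θ} d rf (∧L {φ = φ} {ψ} ρ e) π with ↭-∷-cases (↭-trans (↭-sym π) ρ)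
  ... | inj₂ (_ , Θ↭ , Ξ↭) = ∧L (↭-middle Γ [ φ ∧̇ ψ ] Θ↭) (cut-under ih d rf (φ ∷ ψ ∷ []) e Ξ↭)
  ... | inj₁ (refl , Θ↭Ξ) with rf | ih
  ...   | by-∧R {d = dφ} {e = dψ} | cut-φ , cut-ψ =
    ⊢S-⊆ (++⊆ (⊆.xs⊆xs++ys Γ Θ) (++⊆ (⊆.xs⊆xs++ys Γ Θ) (↭-⊆-++ Γ Θ↭Ξ)))
         (cut-φ dφ (cut-ψ dψ e (swap φ ψ ↭-refl)) (shift φ Γ _))
  cut-right ih {Γ} d rf (∨L {φ = φ} {ψ} ρ e f) π with ↭-∷-cases (↭-trans (↭-sym π) ρ)
  ... | inj₂ (_ , Θ↭ , Ξ↭) =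
    ∨L (↭-middle Γ [ φ ∨̇ ψ ] Θ↭) (cut-under ih d rf [ φ ] e Ξ↭) (cut-under ih d rf [ ψ ] f Ξ↭)
  ... | inj₁ (refl , Θ↭Ξ) with rf | ih
  ...   | by-∨R₁ {d = dφ} | cut-φ , _ = ⊢S-resp-↭ (++⁺ˡ Γ (↭-sym Θ↭Ξ)) (cut-φ dφ e ↭-refl)
  ...   | by-∨R₂ {d = dψ} | _ , cut-ψ = ⊢S-resp-↭ (++⁺ˡ Γ (↭-sym Θ↭Ξ)) (cut-ψ dψ f ↭-refl)
  cut-right ih {Γ} {Θ} d rf (⇒L {φ = φ} {ψ} ρ e f) π with ↭-∷-cases (↭-trans (↭-sym π) ρ)
  ... | inj₂ (_ , Θ↭ , Ξ↭) =
    ⇒L (↭-middle Γ [ φ ⇒̇ ψ ] Θ↭) (cut-under ih d rf [ φ ⇒̇ ψ ] e Ξ↭) (cut-under ih d rf [ ψ ] f Ξ↭)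
  ... | inj₁ (refl , Θ↭Ξ) with rf | ih
  -- The left premise e still contains the cut formula φ ⇒̇ ψ: it is removed by the
  -- induction on the right derivation before φ and ψ are cut.
  ...   | by-⇒R {d = d′} | cut-φ , cut-ψ =
    ⊢S-⊆ (++⊆ (++⊆ (++⊆ (⊆.xs⊆xs++ys Γ Θ) (↭-⊆-++ Γ Θ↭Ξ)) (⊆.xs⊆xs++ys Γ Θ)) (↭-⊆-++ Γ Θ↭Ξ))
         (cut-ψ (cut-φ (cut-right ih d by-⇒R e ↭-refl) d′ ↭-refl) f ↭-refl)
  cut-right ih d rf (∧R e f) π = ∧R (cut-right ih d rf e π) (cut-right ih d rf f π)
  cut-right ih d rf (∨R₁ e) π = ∨R₁ (cut-right ih d rf e π)
  cut-right ih d rf (∨R₂ e) π = ∨R₂ (cut-right ih d rf e π)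
  cut-right ih d rf (⇒R {φ = φ} e) π = ⇒R (cut-under ih d rf [ φ ] e π)
  cut-right ih d rf (□R ps ρ eqs e) π = cut-□R ih d rf ps (↭-trans (↭-sym π) ρ) eqs e
  cut-right ih d rf (◇R ps ρ eqs eq e) π with cut-◇ ih d rf ps (↭-trans (↭-sym π) ρ) eqs e
  ... | diamond-premise boxed split boxed⇔ φ′⇔ premise = ◇R boxed split boxed⇔ (φ′⇔ eq) premise
  cut-right ih d rf (□◇ ps ρ eqs e) π with cut-◇ ih d rf ps (↭-trans (↭-sym π) ρ) eqs e
  ... | diamond-premise boxed split boxed⇔ _ premise = □◇ boxed split boxed⇔ premise

  cut-under : ∀ {χ} → SubformulaCut χ → ∀ {Γ Ξ Ξ₀ Δ} (d : Γ ⊢S just χ) → RightRule d →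
              ∀ Ψ → Ψ ++ Ξ ⊢S Δ → Ξ ↭ χ ∷ Ξ₀ → Ψ ++ Γ ++ Ξ₀ ⊢S Δ
  cut-under ih {Γ} d rf Ψ e Ξ↭ = ⊢S-resp-↭ (shifts Γ Ψ) (cut-right ih d rf e (↭-middle Ψ [ _ ] Ξ↭))

cut-left : ∀ {χ} → SubformulaCut χ → Cut χ
cut-left ih {Θ = Θ} (init ρ) e π =
  ⊢S-⊆ (⊆.⊆-trans (⊆.⊆-reflexive-↭ π)
                  (⊆.∈-∷⁺ʳ (∈-++⁺ˡ (∈-resp-↭ (↭-sym ρ) (here refl))) (⊆.xs⊆ys++xs Θ _))) e
cut-left ih {Θ = Θ} (⊥L ρ) e π = ⊥L (++⁺ʳ Θ ρ)
cut-left ih {Θ = Θ} (∧L ρ d) e π = ∧L (++⁺ʳ Θ ρ) (cut-left ih d e π)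
cut-left ih {Θ = Θ} (∨L ρ d d′) e π = ∨L (++⁺ʳ Θ ρ) (cut-left ih d e π) (cut-left ih d′ e π)
cut-left ih {Θ = Θ} (⇒L ρ d d′) e π = ⇒L (++⁺ʳ Θ ρ) (⊢S-⊆ (⊆.xs⊆xs++ys _ Θ) d) (cut-left ih d′ e π)
cut-left ih {Θ = Θ} (□◇ {Γ = Γ₀} {φ = φ} {ψ} ps ρ eqs d) e π =
  □◇ ps (↭-trans (++⁺ʳ Θ ρ) (↭-reflexive (++-assoc (boxes ps) ((φ ◇→ ψ) ∷ Γ₀) Θ))) eqs d
cut-left ih d@(∧R _ _) = cut-right ih d by-∧R
cut-left ih d@(∨R₁ _) = cut-right ih d by-∨R₁
cut-left ih d@(∨R₂ _) = cut-right ih d by-∨R₂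
cut-left ih d@(⇒R _) = cut-right ih d by-⇒R
cut-left ih d@(□R _ _ _ _) = cut-right ih d by-□R
cut-left ih d@(◇R _ _ _ _ _) = cut-right ih d by-◇R

cut : ∀ χ → Cut χ
subformula-cut : ∀ χ → SubformulaCut χ

cut χ = cut-left (subformula-cut χ)

subformula-cut (var _) = tt
subformula-cut ⊥̇ = tt
subformula-cut (φ ∧̇ ψ) = cut φ , cut ψ
subformula-cut (φ ∨̇ ψ) = cut φ , cut ψ
subformula-cut (φ ⇒̇ ψ) = cut φ , cut ψ
subformula-cut (φ □→ ψ) = cut φ , cut ψ
subformula-cut (φ ◇→ ψ) = cut φ , cut ψ

infix 3 _⊢ₕ_
data _⊢ₕ_ (Γ : Ctx) : Fm → Set where
  hyp : ∀ {φ} → φ ∈ Γ → Γ ⊢ₕ φ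
  thm : ∀ {φ} → ⊢H φ → Γ ⊢ₕ φ
  app : ∀ {φ ψ} → Γ ⊢ₕ φ ⇒̇ ψ → Γ ⊢ₕ φ → Γ ⊢ₕ ψ

⊢H-id : ∀ φ → ⊢H (φ ⇒̇ φ)
⊢H-id φ = mp (mp (ax-S φ (φ ⇒̇ φ) φ) (ax-K φ (φ ⇒̇ φ))) (ax-K φ φ)

deduction : ∀ {Γ φ ψ} → φ ∷ Γ ⊢ₕ ψ → Γ ⊢ₕ φ ⇒̇ ψ
deduction {φ = φ} (hyp (here refl)) = thm (⊢H-id φ)
deduction {φ = φ} {ψ} (hyp (there ψ∈)) = app (thm (ax-K ψ φ)) (hyp ψ∈)
deduction {φ = φ} {ψ} (thm t) = app (thm (ax-K ψ φ)) (thm t)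
deduction {φ = φ} (app {φ = χ} {ψ} d e) = app (app (thm (ax-S φ χ ψ)) (deduction d)) (deduction e)

closed : ∀ {φ} → [] ⊢ₕ φ → ⊢H φ
closed (thm t) = t
closed (app d e) = mp (closed d) (closed e)

⊢ₕ-subst : ∀ {Γ Γ′ φ} → (∀ {χ} → χ ∈ Γ → Γ′ ⊢ₕ χ) → Γ ⊢ₕ φ → Γ′ ⊢ₕ φ
⊢ₕ-subst σ (hyp φ∈) = σ φ∈
⊢ₕ-subst σ (thm t) = thm t
⊢ₕ-subst σ (app d e) = app (⊢ₕ-subst σ d) (⊢ₕ-subst σ e)

⊢ₕ-⊆ : ∀ {Γ Γ′ φ} → Γ ⊆ Γ′ → Γ ⊢ₕ φ → Γ′ ⊢ₕ φ
⊢ₕ-⊆ Γ⊆Γ′ = ⊢ₕ-subst (hyp ∘ Γ⊆Γ′)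

∧-intro : ∀ {Γ φ ψ} → Γ ⊢ₕ φ → Γ ⊢ₕ ψ → Γ ⊢ₕ φ ∧̇ ψ
∧-intro {φ = φ} {ψ} d e = app (app (thm (ax-∧I φ ψ)) d) e

∧-elimˡ : ∀ {Γ φ ψ} → Γ ⊢ₕ φ ∧̇ ψ → Γ ⊢ₕ φ
∧-elimˡ {φ = φ} {ψ} = app (thm (ax-∧E₁ φ ψ))

∧-elimʳ : ∀ {Γ φ ψ} → Γ ⊢ₕ φ ∧̇ ψ → Γ ⊢ₕ ψ
∧-elimʳ {φ = φ} {ψ} = app (thm (ax-∧E₂ φ ψ))

⊥-elimₕ : ∀ {Γ φ} → Γ ⊢ₕ ⊥̇ → Γ ⊢ₕ φ
⊥-elimₕ {φ = φ} = app (thm (ax-⊥E φ))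

□-mono : ∀ {Γ φ χ ψ} → ⊢H (χ ⇒̇ ψ) → Γ ⊢ₕ φ □→ χ → Γ ⊢ₕ φ □→ ψ
□-mono {φ = φ} {χ} {ψ} χ⇒ψ d =
  ∧-elimʳ (app (thm (CM□ φ χ ψ)) (app (∧-elimˡ (thm (RC□ φ χ⇔χ∧ψ))) d))
  where
    χ⇔χ∧ψ : ⊢H (χ ⇔̇ (χ ∧̇ ψ))
    χ⇔χ∧ψ = closed (∧-intro (deduction (∧-intro (hyp (here refl)) (app (thm χ⇒ψ) (hyp (here refl)))))
                            (thm (ax-∧E₁ χ ψ)))

□-rule : ∀ {φ ψ} ps → All (λ p → ⊢H (φ ⇔̇ proj₁ p)) ps → map proj₂ ps ⊢ₕ ψ → boxes ps ⊢ₕ φ □→ ψ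
□-rule {φ} {ψ} [] [] d = app (∧-elimˡ (thm (RC□ φ ⊤⇔ψ))) (thm (CN□ φ))
  where
    ⊤⇔ψ : ⊢H (⊤̇ ⇔̇ ψ)
    ⊤⇔ψ = closed (∧-intro (app (thm (ax-K ψ ⊤̇)) d) (deduction (deduction (hyp (here refl)))))
□-rule {φ} {ψ} ((ρ , σ) ∷ ps) (φ⇔ρ ∷ eqs) d =
  □-mono modus-ponens (app (thm (CC□ φ σ (σ ⇒̇ ψ))) (∧-intro φ□σ φ□σ⇒ψ))
  where
    modus-ponens : ⊢H (σ ∧̇ (σ ⇒̇ ψ) ⇒̇ ψ)
    modus-ponens = closed (deduction (app (∧-elimʳ (hyp (here refl))) (∧-elimˡ (hyp (here refl)))))
    φ□σ : (ρ □→ σ) ∷ boxes ps ⊢ₕ φ □→ σ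
    φ□σ = app (∧-elimʳ (thm (RA□ σ φ⇔ρ))) (hyp (here refl))
    φ□σ⇒ψ : (ρ □→ σ) ∷ boxes ps ⊢ₕ φ □→ (σ ⇒̇ ψ)
    φ□σ⇒ψ = ⊢ₕ-⊆ (⊆.xs⊆x∷xs _ _) (□-rule ps eqs (deduction d))

□-sound : ∀ {Γ′ Γ φ ψ} ps → Γ′ ↭ boxes ps ++ Γ → All (λ p → ⊢H (φ ⇔̇ proj₁ p)) ps →
          map proj₂ ps ⊢ₕ ψ → Γ′ ⊢ₕ φ □→ ψ
□-sound ps π eqs d = ⊢ₕ-⊆ (⊆.⊆-trans (⊆.xs⊆xs++ys _ _) (⊆.⊆-reflexive-↭ (↭-sym π))) (□-rule ps eqs d)

◇-sound : ∀ {Γ′ Γ φ ψ ϑ} ps → Γ′ ↭ boxes ps ++ (φ ◇→ ψ) ∷ Γ → All (λ p → ⊢H (φ ⇔̇ proj₁ p)) ps →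
          map proj₂ ps ++ [ ψ ] ⊢ₕ ϑ → Γ′ ⊢ₕ φ ◇→ ϑ
◇-sound {Γ′} {φ = φ} {ψ} {ϑ} ps π eqs d =
  app (app (thm (CK◇ φ ψ ϑ)) (□-sound ps π eqs (deduction (⊢ₕ-⊆ ψ-first d)))) (hyp ◇∈)
  where
    ψ-first : map proj₂ ps ++ [ ψ ] ⊆ ψ ∷ map proj₂ ps
    ψ-first = ⊆.⊆-reflexive-↭ (++-comm (map proj₂ ps) [ ψ ])
    ◇∈ : (φ ◇→ ψ) ∈ Γ′
    ◇∈ = ⊆.⊆-reflexive-↭ (↭-sym π) (∈-++⁺ʳ (boxes ps) (here refl))

principal : ∀ {Γ′ Γ φ} → Γ′ ↭ φ ∷ Γ → Γ′ ⊢ₕ φ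
principal π = hyp (⊆.⊆-reflexive-↭ (↭-sym π) (here refl))

⊢ₕ-side : ∀ {Γ′ Γ φ ψ} → Γ′ ↭ φ ∷ Γ → Γ ⊢ₕ ψ → Γ′ ⊢ₕ ψ
⊢ₕ-side π = ⊢ₕ-⊆ (⊆.⊆-trans (⊆.xs⊆x∷xs _ _) (⊆.⊆-reflexive-↭ (↭-sym π)))

mutual
  ⇔-sound : ∀ {φ ρ} → φ ⊢S⇔ ρ → ⊢H (φ ⇔̇ ρ)
  ⇔-sound (d , e) = closed (∧-intro (deduction (sound d)) (deduction (sound e)))

  ⇔-sound* : ∀ {φ} {ps : List (Fm × Fm)} → All (λ p → φ ⊢S⇔ proj₁ p) ps →
             All (λ p → ⊢H (φ ⇔̇ proj₁ p)) ps
  ⇔-sound* [] = []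
  ⇔-sound* (e ∷ es) = ⇔-sound e ∷ ⇔-sound* es

  sound : ∀ {Γ Δ} → Γ ⊢S Δ → Γ ⊢ₕ ⋁ Δ
  sound (init π) = principal π
  sound (⊥L π) = ⊥-elimₕ (principal π)
  sound (∧L π d) = app (app (⊢ₕ-side π (deduction (deduction (sound d)))) (∧-elimʳ (principal π)))
                       (∧-elimˡ (principal π))
  sound {Δ = Δ} (∨L {φ = φ} {ψ} π d e) =
    app (app (app (thm (ax-∨E φ ψ (⋁ Δ))) (⊢ₕ-side π (deduction (sound d))))
             (⊢ₕ-side π (deduction (sound e))))
        (principal π)
  sound (⇒L π d e) = app (⊢ₕ-side π (deduction (sound e)))
                         (app (principal π) (⊢ₕ-⊆ (⊆.⊆-reflexive-↭ (↭-sym π)) (sound d)))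
  sound (∧R d e) = ∧-intro (sound d) (sound e)
  sound (∨R₁ {φ = φ} {ψ} d) = app (thm (ax-∨I₁ φ ψ)) (sound d)
  sound (∨R₂ {φ = φ} {ψ} d) = app (thm (ax-∨I₂ φ ψ)) (sound d)
  sound (⇒R d) = deduction (sound d)
  sound (□R ps π eqs d) = □-sound ps π (⇔-sound* eqs) (sound d)
  sound (◇R {ϑ = ϑ} ps π eqs eq d) =
    app (∧-elimˡ (thm (RA◇ ϑ (⇔-sound eq)))) (◇-sound ps π (⇔-sound* eqs) (sound d))
  sound (□◇ {φ = φ} ps π eqs d) =
    ⊥-elimₕ (app (thm (CN◇ φ)) (◇-sound ps π (⇔-sound* eqs) (sound d)))

⊢S-mp : ∀ {Γ φ ψ} → Γ ⊢S just (φ ⇒̇ ψ) → Γ ⊢S just φ → Γ ⊢S just ψ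
⊢S-mp {φ = φ} {ψ} d e =
  ⊢S-⊆ (++⊆ ⊆.⊆-refl ⊆.⊆-refl) (cut (φ ⇒̇ ψ) d (⇒L ↭-refl (⊢S-⊆ (⊆.xs⊆x∷xs _ _) e) (⊢S-id ψ)) ↭-refl)

⇒-inv : ∀ {φ ψ} → [] ⊢S just (φ ⇒̇ ψ) → [ φ ] ⊢S just ψ
⇒-inv {φ} d = ⊢S-mp (⊢S-⊆ (λ ()) d) (⊢S-id φ)

⇔-complete : ∀ {φ ψ} → [] ⊢S just (φ ⇔̇ ψ) → φ ⊢S⇔ ψ
⇔-complete {φ} {ψ} d = ⇒-inv (⊢S-mp (⇒R (∧L ↭-refl #0)) d) , ⇒-inv (⊢S-mp (⇒R (∧L ↭-refl #1)) d)

⇔-refl : ∀ φ → φ ⊢S⇔ φ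
⇔-refl φ = ⊢S-id φ , ⊢S-id φ

⇔-sym : ∀ {φ ψ} → φ ⊢S⇔ ψ → ψ ⊢S⇔ φ
⇔-sym (d , e) = e , d

complete : ∀ {φ} → ⊢H φ → [] ⊢S just φ
complete (ax-K φ ψ) = ⇒R (⇒R #1)
complete (ax-S φ ψ χ) = ⇒R (⇒R (⇒R (⊢S-mp (⊢S-mp #2 #0) (⊢S-mp #1 #0))))
complete (ax-∧E₁ φ ψ) = ⇒R (∧L ↭-refl #0)
complete (ax-∧E₂ φ ψ) = ⇒R (∧L ↭-refl #1)
complete (ax-∧I φ ψ) = ⇒R (⇒R (∧R #1 #0))
complete (ax-∨I₁ φ ψ) = ⇒R (∨R₁ #0)
complete (ax-∨I₂ φ ψ) = ⇒R (∨R₂ #0)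
complete (ax-∨E φ ψ χ) = ⇒R (⇒R (⇒R (∨L ↭-refl (⊢S-mp #2 #0) (⊢S-mp #1 #0))))
complete (ax-⊥E φ) = ⇒R (⊥L ↭-refl)
complete (mp d e) = ⊢S-mp (complete d) (complete e)
complete (CM□ φ ψ χ) = ⇒R (∧R (□R [ (φ , ψ ∧̇ χ) ] ↭-refl (⇔-refl φ ∷ []) (∧L ↭-refl #0))
                              (□R [ (φ , ψ ∧̇ χ) ] ↭-refl (⇔-refl φ ∷ []) (∧L ↭-refl #1)))
complete (CC□ φ ψ χ) = ⇒R (∧L ↭-refl (□R ((φ , ψ) ∷ (φ , χ) ∷ []) ↭-refl (⇔-refl φ ∷ ⇔-refl φ ∷ [])
                                          (∧R #0 #1)))
complete (CN□ φ) = □R [] ↭-refl [] (⇒R (⊥L ↭-refl))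
complete (CN◇ φ) = ⇒R (□◇ [] ↭-refl [] (⊥L ↭-refl))
complete (CK◇ φ ψ χ) = ⇒R (⇒R (◇R [ (φ , ψ ⇒̇ χ) ] (swap _ _ ↭-refl) (⇔-refl φ ∷ []) (⇔-refl φ)
                                  (⊢S-mp #0 #1)))
complete (RA□ {φ} {ρ} ψ h) = ∧R (⇒R (□R [ (φ , ψ) ] ↭-refl (⇔-sym φ⇔ρ ∷ []) #0))
                                (⇒R (□R [ (ρ , ψ) ] ↭-refl (φ⇔ρ ∷ []) #0))
  where
    φ⇔ρ : φ ⊢S⇔ ρ
    φ⇔ρ = ⇔-complete (complete h)
complete (RC□ φ {ψ} {χ} h) with ⇔-complete (complete h)
... | ψ⇒χ , χ⇒ψ = ∧R (⇒R (□R [ (φ , ψ) ] ↭-refl (⇔-refl φ ∷ []) ψ⇒χ))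
                     (⇒R (□R [ (φ , χ) ] ↭-refl (⇔-refl φ ∷ []) χ⇒ψ))
complete (RA◇ {φ} {ρ} ψ h) = ∧R (⇒R (◇R [] ↭-refl [] φ⇔ρ #0)) (⇒R (◇R [] ↭-refl [] (⇔-sym φ⇔ρ) #0))
  where
    φ⇔ρ : φ ⊢S⇔ ρ
    φ⇔ρ = ⇔-complete (complete h)
complete (RC◇ φ h) with ⇔-complete (complete h)
... | ψ⇒χ , χ⇒ψ = ∧R (⇒R (◇R [] ↭-refl [] (⇔-refl φ) ψ⇒χ)) (⇒R (◇R [] ↭-refl [] (⇔-refl φ) χ⇒ψ))

⋀⁺-elim : ∀ φ Γ {χ} → χ ∈ φ ∷ Γ → [ ⋀⁺ φ Γ ] ⊢ₕ χ
⋀⁺-elim φ [] (here refl) = hyp (here refl)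
⋀⁺-elim φ (ψ ∷ Γ) (here refl) = ∧-elimˡ (hyp (here refl))
⋀⁺-elim φ (ψ ∷ Γ) (there χ∈) = ⊢ₕ-subst (λ { (here refl) → ∧-elimʳ (hyp (here refl)) }) (⋀⁺-elim ψ Γ χ∈)

⊩-⋀⁺ : ∀ {Θ} φ Γ → All (Θ ⊩_) (φ ∷ Γ) → Θ ⊩ ⋀⁺ φ Γ
⊩-⋀⁺ φ [] (⊩φ ∷ []) = ⊩φ
⊩-⋀⁺ φ (ψ ∷ Γ) (⊩φ ∷ ⊩Γ) = inj₂ (⊩φ , ⊩-⋀⁺ ψ Γ ⊩Γ)

⋁-elim : ∀ {Γ} Δ → Γ ⊢S just (⋁ Δ) → Γ ⊢S Δ
⋁-elim (just _) d = d
⋁-elim nothing d = subst (_⊢S nothing) (++-identityʳ _) (cut ⊥̇ d (⊥L ↭-refl) ↭-refl)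

ι-sound : ∀ Γ {Δ} → Γ ⊢S Δ → ⊢H ι Γ Δ
ι-sound [] d = closed (sound d)
ι-sound (φ ∷ Γ) d = closed (deduction (⊢ₕ-subst (⋀⁺-elim φ Γ) (sound d)))

ι-complete : ∀ Γ Δ → ⊢H ι Γ Δ → Γ ⊢S Δ
ι-complete [] Δ h = ⋁-elim Δ (complete h)
ι-complete (φ ∷ Γ) Δ h = ⋁-elim Δ (⊢S-mono (⊩-⋀⁺ φ Γ (⊆⇒⊩ ⊆.⊆-refl) ∷ []) (⇒-inv (complete h)))

theorem5 : (Γ : Ctx) (Δ : Succ) → ((Γ ⊢S Δ → ⊢H ι Γ Δ) × (⊢H ι Γ Δ → Γ ⊢S Δ))
theorem5 Γ Δ = ι-sound Γ , ι-complete Γ Δ
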